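{- $\vdash x\prec y\to x<y$.
   Context: PRA (Primitive Recursive Arithmetic) is the quantifier-free formal system whose symbols are variables, PR function symbols, $=$, $\neg$, $\vee$; formulas are built from equations by $\neg,\vee$, with $\wedge,\to,\leftrightarrow$ the usual abbreviations. A function symbol is defined by primitive recursion by $f(\vec x,0)=a$, $f(\vec x,Sy)=b_z(f(\vec x,y))$; PR function symbols are those obtainable from $0$ and $S$ by finitely many such definitions. Axioms: defining equations; $\neg\,Sx=0$; $Sx=Sy\to x=y$; $x=x$; $x=y\to y=x$; $x=y\wedge A_x(x)\to A_x(y)$; propositional axioms $A\vee A\to A$, $A\to A\vee B$, $A\vee B\to B\vee A$, $(B\to C)\to(A\vee B\to A\vee C)$. Rules: instance, modus ponens, induction. $\vdash$ denotes provability in PRA. Symbols: $x+0=x$, $x+Sy=S(x+y)$; $P0=0$, $PSx=x$; $x-0=x$, $x-Sy=P(x-y)$; $C(0,y,z)=y$, $C(Sx,y,z)=z$; $\mathrm{Eq}(x,y)=(x-y)+(y-x)$; $x\mathrel{\dot=}y=C(\mathrm{Eq}(x,y),0,S0)$, $\dot\neg x=C(x,S0,0)$, $x\mathbin{\dot\vee}y=C(x,0,C(y,0,S0))$, $\chi A$ replaces $=,\neg,\vee$ by these. $x\cdot0=0$, $x\cdot Sy=x+x\cdot y$; $x\uparrow0=S0$, $x\uparrow Sy=x\cdot(x\uparrow y)$; $1=S0$, $2=SS0$; $x\le y$ abbreviates $x-y=0$, $x<y$ abbreviates $x\le y\wedge x\ne y$. For a formula $B$ in variable $q$ with other variables $\vec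 y$: $\mu_B(\vec y,0)=C(\chi[B_q(0)],0,S0)$, $\mu_B(\vec y,Sq)=C(\chi[\mu_B(\vec y,q)\le q],\mu_B(\vec y,q),C(\chi[B_q(Sq)],Sq,SSq))$; $\exists q{\le}b\,B$ abbreviates $B_q(\mu_B(\vec y,b))$. "$q$ is a power of two" abbreviates $\exists x{\le}q[2\uparrow x=q]$. $Qx$ abbreviates $\mu_B(x,Sx)$ where $B$ is "$q$ is a power of two $\wedge\ q\le Sx\wedge Sx<2\cdot q$"; it satisfies $\vdash Qx=q\leftrightarrow B$. $Rx=Sx-Qx$. $x\oplus y=P(Sx\cdot Qy+Ry)$. $\varepsilon=0$, $\bar0=1$, $\bar1=2$. $\mathrm{Length}$ is the PR function symbol defined (by a primitive recursion by cases on the last bit) so that $\vdash\mathrm{Length}\,\varepsilon=0\wedge\mathrm{Length}(x\oplus\bar0)=S\,\mathrm{Length}\,x\wedge\mathrm{Length}(x\oplus\bar1)=S\,\mathrm{Length}\,x$. $x\prec y$ abbreviates $\mathrm{Length}\,x<\mathrm{Length}\,y$. -}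

module Defs where

open import Data.Nat using (ℕ; zero; suc; _≡ᵇ_)
open import Data.Fin using (Fin; toℕ) renaming (zero to fz; suc to fs)
open import Data.Vec using (Vec; []; _∷_; _∷ʳ_; map; tabulate)
open import Data.Bool using (if_then_else_)

-- A PR function symbol of arity k is 0 (arity 0), S (arity 1), or
-- f of arity (suc n) introduced by primitive recursion
--   f(x_0,…,x_{n-1},0)  = a
--   f(x_0,…,x_{n-1},Sy) = b_z(f(x_0,…,x_{n-1},y))
-- where a : Tm (Fin n)   (variable i stands for x_i), and
--       b : Tm (Fin (2+n)) (variable 0 = z, variable 1 = y,
--                           variable (2+i) = x_i),
-- both built from previously defined symbols.

data Fn : ℕ → Set
data Tm (V : Set) : Set

data Fn where
  zeroF : Fn 0
  sucF  : Fn 1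
  recF  : ∀ {n} → Tm (Fin n) → Tm (Fin (suc (suc n))) → Fn (suc n)

data Tm V where
  var : V → Tm V
  app : ∀ {k} → Fn k → Vec (Tm V) k → Tm V

sub  : ∀ {V W : Set} → (V → Tm W) → Tm V → Tm W
subs : ∀ {V W : Set} {k} → (V → Tm W) → Vec (Tm V) k → Vec (Tm W) k
sub σ (var v)    = σ v
sub σ (app f ts) = app f (subs σ ts)
subs σ []       = []
subs σ (t ∷ ts) = sub σ t ∷ subs σ ts

infix  6 _≐_
infixr 4 _∨_
infixr 3 _∧_
infixr 2 _⇒_

data Fm (V : Set) : Set where
  _≐_ : Tm V → Tm V → Fm V
  ~_  : Fm V → Fm V
  _∨_ : Fm V → Fm V → Fm V

_⇒_ : ∀ {V} → Fm V → Fm V → Fm V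
A ⇒ B = ~ A ∨ B

_∧_ : ∀ {V} → Fm V → Fm V → Fm V
A ∧ B = ~ (~ A ∨ ~ B)

subF : ∀ {V W : Set} → (V → Tm W) → Fm V → Fm W
subF σ (s ≐ t) = sub σ s ≐ sub σ t
subF σ (~ A)   = ~ subF σ A
subF σ (A ∨ B) = subF σ A ∨ subF σ B

Term : Set
Term = Tm ℕ

Formula : Set
Formula = Fm ℕ

_[_≔_] : Formula → ℕ → Term → Formula
A [ x ≔ t ] = subF (λ k → if k ≡ᵇ x then t else var k) A

Z : ∀ {V} → Tm V
Z = app zeroF []

S : ∀ {V} → Tm V → Tm V
S t = app sucF (t ∷ [])

vars : (n : ℕ) → Vec Term n
vars n = tabulate (λ i → var (toℕ i))

data ⊢_ : Formula → Set where
  ax-rec0 : ∀ {n} (a : Tm (Fin n)) (b : Tm (Fin (suc (suc n)))) →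
    ⊢ (app (recF a b) (vars n ∷ʳ Z) ≐ sub (λ i → var (toℕ i)) a)
  ax-recS : ∀ {n} (a : Tm (Fin n)) (b : Tm (Fin (suc (suc n)))) →
    ⊢ (app (recF a b) (vars n ∷ʳ S (var n))
        ≐ sub (λ { fz → app (recF a b) (vars n ∷ʳ var n)
                 ; (fs fz) → var n
                 ; (fs (fs i)) → var (toℕ i) }) b)
  ax-S≠0  : ⊢ (~ (S (var 0) ≐ Z))
  ax-Sinj : ⊢ (S (var 0) ≐ S (var 1) ⇒ var 0 ≐ var 1)
  ax-refl : ⊢ (var 0 ≐ var 0)
  ax-sym  : ⊢ (var 0 ≐ var 1 ⇒ var 1 ≐ var 0)
  ax-eq   : (A : Formula) (x y : ℕ) → ⊢ ((var x ≐ var y ∧ A) ⇒ A [ x ≔ var y ])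
  ax-contr : (A : Formula) → ⊢ (A ∨ A ⇒ A)
  ax-weak  : (A B : Formula) → ⊢ (A ⇒ A ∨ B)
  ax-perm  : (A B : Formula) → ⊢ (A ∨ B ⇒ B ∨ A)
  ax-assoc : (A B C : Formula) → ⊢ ((B ⇒ C) ⇒ (A ∨ B ⇒ A ∨ C))
  instance' : (σ : ℕ → Term) {A : Formula} → ⊢ A → ⊢ subF σ A
  mp : {A B : Formula} → ⊢ A → ⊢ (A ⇒ B) → ⊢ B
  ind : (x : ℕ) {A : Formula} → ⊢ (A [ x ≔ Z ]) → ⊢ (A ⇒ A [ x ≔ S (var x) ]) → ⊢ A

-- x + 0 = x, x + Sy = S(x + y)
plusF : Fn 2
plusF = recF (var fz) (S (var fz))

_+'_ : ∀ {V} → Tm V → Tm V → Tm V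
s +' t = app plusF (s ∷ t ∷ [])

-- P0 = 0, PSx = x
predF : Fn 1
predF = recF Z (var (fs fz))

P : ∀ {V} → Tm V → Tm V
P t = app predF (t ∷ [])

-- x - 0 = x, x - Sy = P(x - y)
monusF : Fn 2
monusF = recF (var fz) (P (var fz))

_-'_ : ∀ {V} → Tm V → Tm V → Tm V
s -' t = app monusF (s ∷ t ∷ [])

-- C(0,y,z) = y, C(Sx,y,z) = z.  Our recursion scheme recurses on the
-- last argument, so the symbol takes its arguments in the order (y,z,x).
condF : Fn 3
condF = recF (var fz) (var (fs (fs (fs fz))))

C : ∀ {V} → Tm V → Tm V → Tm V → Tm V
C x y z = app condF (y ∷ z ∷ x ∷ [])

Eq : ∀ {V} → Tm V → Tm V → Tm V
Eq s t = (s -' t) +' (t -' s)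

eqᵈ : ∀ {V} → Tm V → Tm V → Tm V
eqᵈ s t = C (Eq s t) Z (S Z)

notᵈ : ∀ {V} → Tm V → Tm V
notᵈ s = C s (S Z) Z

orᵈ : ∀ {V} → Tm V → Tm V → Tm V
orᵈ s t = C s Z (C t Z (S Z))

χ : ∀ {V} → Fm V → Tm V
χ (s ≐ t) = eqᵈ s t
χ (~ A)   = notᵈ (χ A)
χ (A ∨ B) = orᵈ (χ A) (χ B)

-- x · 0 = 0, x · Sy = x + x · y
timesF : Fn 2
timesF = recF Z (var (fs (fs fz)) +' var fz)

_·_ : ∀ {V} → Tm V → Tm V → Tm V
s · t = app timesF (s ∷ t ∷ [])

-- x ↑ 0 = S0, x ↑ Sy = x · (x ↑ y)
powF : Fn 2
powF = recF (S Z) (var (fs (fs fz)) · var fz)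

_↑_ : ∀ {V} → Tm V → Tm V → Tm V
s ↑ t = app powF (s ∷ t ∷ [])

one two : ∀ {V} → Tm V
one = S Z
two = S (S Z)

_≤'_ : ∀ {V} → Tm V → Tm V → Fm V
s ≤' t = (s -' t) ≐ Z

_<'_ : ∀ {V} → Tm V → Tm V → Fm V
s <' t = (s ≤' t) ∧ ~ (s ≐ t)

-- μ_B for a formula B in the variable q (= fz) with other variables
-- y_0,…,y_{k-1} (= fs i).  The symbol μ_B takes arguments (y⃗, q).
μ : ∀ {k} → Fm (Fin (suc k)) → Fn (suc k)
μ {k} B = recF a b
  where
  a : Tm (Fin k)
  a = C (χ (subF (λ { fz → Z ; (fs i) → var i }) B)) Z (S Z)
  z q : Tm (Fin (suc (suc k)))
  z = var fz
  q = var (fs fz)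
  b : Tm (Fin (suc (suc k)))
  b = C (χ (z ≤' q)) z
        (C (χ (subF (λ { fz → S q ; (fs i) → var (fs (fs i)) }) B)) (S q) (S (S q)))

-- "q is a power of two" = ∃x≤q [2 ↑ x = q], i.e. B'_x(μ_{B'}(q,q))
-- with B' = (2 ↑ x = q), x the bound variable (fz), q the other (fs fz).
pow2B : Fm (Fin 2)
pow2B = (two ↑ var fz) ≐ var (fs fz)

isPow2 : ∀ {V} → Tm V → Fm V
isPow2 t = subF (λ { fz → app (μ pow2B) (t ∷ t ∷ []) ; (fs _) → t }) pow2B

QB : Fm (Fin 2)
QB = isPow2 q ∧ (q ≤' S x) ∧ (S x <' (two · q))
  where
  q x : Tm (Fin 2)
  q = var fz
  x = var (fs fz)

Q : ∀ {V} → Tm V → Tm V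
Q t = app (μ QB) (t ∷ S t ∷ [])

R : ∀ {V} → Tm V → Tm V
R t = S t -' Q t

_⊕_ : ∀ {V} → Tm V → Tm V → Tm V
s ⊕ t = P ((S s · Q t) +' R t)

ε bit0 bit1 : ∀ {V} → Tm V
ε = Z
bit0 = one
bit1 = two

LengthSpec : Fn 1 → Formula
LengthSpec L =
  (Lt ε ≐ Z) ∧ (Lt (x ⊕ bit0) ≐ S (Lt x)) ∧ (Lt (x ⊕ bit1) ≐ S (Lt x))
  where
  Lt : Term → Term
  Lt t = app L (t ∷ [])
  x : Term
  x = var 0

_≺[_]_ : Term → Fn 1 → Term → Formula
s ≺[ L ] t = app L (s ∷ []) <' app L (t ∷ [])

module Submission where

-- Appending a bit to x gives x ⊕ 0̄ = 2x+1 and x ⊕ 1̄ = 2x+2, so every m > 0 is chop m ⊕ b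
-- for chop m = ⌊(m-1)/2⌋ and a bit b, and Length m = 1 + Length (chop m).  Chopping Length x
-- times therefore reaches 0.  The step property Length (m+1) ∈ {Length m, Length m + 1} passes
-- from chop m to m, and chopping reduces every m to 0 where it holds; so Length is monotone,
-- and Length x < Length y rules out y ≤ x.  The values Q 1, R 1, Q 2, R 2 needed for ⊕ are
-- obtained inside PRA by evaluating closed terms.

open import Defs
open import Data.Nat using (ℕ; zero; suc; _+_; _≟_)
open import Data.Fin using (Fin; toℕ) renaming (zero to fz; suc to fs)
open import Data.List using (List; []; _∷_; _++_)
import Data.List as List
open import Data.List.Membership.Propositional using (_∈_)
open import Data.List.Relation.Unary.Any using (here; there)
open import Data.List.Relation.Unary.Any.Properties using (++⁺ˡ; ++⁺ʳ; ++⁻)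
open import Data.Maybe using (Maybe; just; nothing; From-just; from-just)
import Data.Maybe as Maybe
open import Data.Product using (Σ; _×_; _,_; proj₂)
open import Data.Sum using (inj₁; inj₂)
open import Relation.Nullary using (yes; no)
open import Data.Vec using (Vec; []; _∷_; _∷ʳ_; lookup; map; tabulate; _[_]≔_; init; last; initLast)
open import Data.Vec.Properties
  using (map-[]≔; map-∷ʳ; lookup-map; tabulate-∘; tabulate-cong; tabulate∘lookup; []≔-lookup)
open import Function using (_∘_)
open import Relation.Binary.PropositionalEquality using (_≡_; refl; sym; trans; cong; cong₂; subst; subst₂)

-- Propositional reasoning

⇒-trans : ∀ {A B C} → ⊢ (A ⇒ B) → ⊢ (B ⇒ C) → ⊢ (A ⇒ C)
⇒-trans {A} {B} {C} p q = mp p (mp q (ax-assoc (~ A) B C))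

⇒-refl : ∀ {A} → ⊢ (A ⇒ A)
⇒-refl {A} = ⇒-trans (ax-weak A A) (ax-contr A)

∨-swap : ∀ {A B} → ⊢ (A ∨ B) → ⊢ (B ∨ A)
∨-swap {A} {B} p = mp p (ax-perm A B)

∨-inr : ∀ {A B} → ⊢ (B ⇒ A ∨ B)
∨-inr {A} {B} = ⇒-trans (ax-weak B A) (ax-perm B A)

∨-monoʳ : ∀ {A B C} → ⊢ (B ⇒ C) → ⊢ (A ∨ B ⇒ A ∨ C)
∨-monoʳ {A} {B} {C} p = mp p (ax-assoc A B C)

∨-monoˡ : ∀ {A B C} → ⊢ (A ⇒ B) → ⊢ (A ∨ C ⇒ B ∨ C)
∨-monoˡ {A} {B} {C} p = ⇒-trans (ax-perm A C) (⇒-trans (∨-monoʳ p) (ax-perm C B))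

∨-elim : ∀ {A B C} → ⊢ (A ⇒ C) → ⊢ (B ⇒ C) → ⊢ (A ∨ B ⇒ C)
∨-elim {A} {B} {C} p q = ⇒-trans (∨-monoʳ q) (⇒-trans (∨-monoˡ p) (ax-contr C))

¬¬-intro : ∀ {A} → ⊢ (A ⇒ ~ ~ A)
¬¬-intro {A} = ∨-swap (⇒-refl {~ A})

∨-assocˡ : ∀ {A B C} → ⊢ (A ∨ (B ∨ C) ⇒ (A ∨ B) ∨ C)
∨-assocˡ {A} {B} {C} =
  ∨-elim (⇒-trans (ax-weak A B) (ax-weak (A ∨ B) C))
         (∨-elim (⇒-trans (∨-inr {A}) (ax-weak (A ∨ B) C)) (∨-inr {A ∨ B}))

⊤ᶠ ⊥ᶠ : Formula
⊤ᶠ = Z ≐ Z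
⊥ᶠ = ~ ⊤ᶠ

≐-refl : ∀ u → ⊢ (u ≐ u)
≐-refl u = instance' (λ _ → u) ax-refl

⊤-intro : ⊢ ⊤ᶠ
⊤-intro = ≐-refl Z

⊥-elim : ∀ {A} → ⊢ (⊥ᶠ ⇒ A)
⊥-elim {A} = mp (mp ⊤-intro ¬¬-intro) (ax-weak (~ ⊥ᶠ) A)

-- Propositional tautologies are derived by a proof search in a one-sided
-- sequent calculus whose sequent Γ is read as the disjunction ⋁ Γ.

⋁ : List Formula → Formula
⋁ []          = ⊥ᶠ
⋁ (A ∷ [])    = A
⋁ (A ∷ B ∷ Γ) = A ∨ ⋁ (B ∷ Γ)

∈⇒⋁ : ∀ {A Γ} → A ∈ Γ → ⊢ (A ⇒ ⋁ Γ)
∈⇒⋁ {Γ = _ ∷ []}        (here refl) = ⇒-refl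
∈⇒⋁ {Γ = A ∷ B ∷ Γ}     (here refl) = ax-weak A (⋁ (B ∷ Γ))
∈⇒⋁ {Γ = C ∷ _ ∷ _}     (there p)   = ⇒-trans (∈⇒⋁ p) (∨-inr {C})

⋁-⊆ : ∀ {Γ Δ} → (∀ {A} → A ∈ Γ → A ∈ Δ) → ⊢ ⋁ Γ → ⊢ ⋁ Δ
⋁-⊆ {Γ} Γ⊆Δ p = mp p (⋁-⊆⇒ Γ Γ⊆Δ)
  where
  ⋁-⊆⇒ : ∀ {Δ} Γ → (∀ {A} → A ∈ Γ → A ∈ Δ) → ⊢ (⋁ Γ ⇒ ⋁ Δ)
  ⋁-⊆⇒ []          _   = ⊥-elim
  ⋁-⊆⇒ (A ∷ [])    Γ⊆Δ = ∈⇒⋁ (Γ⊆Δ (here refl))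
  ⋁-⊆⇒ (A ∷ B ∷ Γ) Γ⊆Δ = ∨-elim (∈⇒⋁ (Γ⊆Δ (here refl))) (⋁-⊆⇒ (B ∷ Γ) (Γ⊆Δ ∘ there))

⋁-head : ∀ {A A′} Γ → ⊢ (A ⇒ A′) → ⊢ ⋁ (A ∷ Γ) → ⊢ ⋁ (A′ ∷ Γ)
⋁-head []      p q = mp q p
⋁-head (_ ∷ _) p q = mp q (∨-monoˡ p)

⋁-∨ : ∀ {A B} Γ → ⊢ ⋁ (A ∷ B ∷ Γ) → ⊢ ⋁ ((A ∨ B) ∷ Γ)
⋁-∨ []      p = p
⋁-∨ (_ ∷ _) p = mp p ∨-assocˡ

⋁-¬∨ : ∀ {A B} Γ → ⊢ ⋁ (~ A ∷ Γ) → ⊢ ⋁ (~ B ∷ Γ) → ⊢ ⋁ (~ (A ∨ B) ∷ Γ)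
⋁-¬∨ {A} {B} [] p q =
  mp (∨-elim (mp p (ax-weak (~ A) (~ (A ∨ B)))) (mp q (ax-weak (~ B) (~ (A ∨ B))))) (ax-contr _)
⋁-¬∨ (_ ∷ _) p q = ∨-elim p q

⋁-rotate : ∀ {A} Γ Δ → ⊢ ⋁ (Γ ++ A ∷ Δ) → ⊢ ⋁ (A ∷ Γ ++ Δ)
⋁-rotate {A} Γ Δ = ⋁-⊆ move
  where
  move : ∀ {B} → B ∈ Γ ++ A ∷ Δ → B ∈ A ∷ Γ ++ Δ
  move p with ++⁻ Γ p
  ... | inj₁ q           = there (++⁺ˡ q)
  ... | inj₂ (here eq)   = here eq
  ... | inj₂ (there q)   = there (++⁺ʳ Γ q)

data Schema : Set where
  atom : ℕ → Schema
  neg  : Schema → Schema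
  or   : Schema → Schema → Schema

imp and : Schema → Schema → Schema
imp a b = or (neg a) b
and a b = neg (or (neg a) (neg b))

p₀ p₁ p₂ p₃ : Schema
p₀ = atom 0
p₁ = atom 1
p₂ = atom 2
p₃ = atom 3

size : Schema → ℕ
size (atom _) = 1
size (neg a)  = suc (size a)
size (or a b) = suc (size a + size b)

module _ (ρ : ℕ → Formula) where

  ⟦_⟧ : Schema → Formula
  ⟦ atom i ⟧ = ρ i
  ⟦ neg a ⟧  = ~ ⟦ a ⟧
  ⟦ or a b ⟧ = ⟦ a ⟧ ∨ ⟦ b ⟧

  ⟦_⟧* : List Schema → List Formula
  ⟦_⟧* = List.map ⟦_⟧

  findNeg : ∀ i L → Maybe (~ ρ i ∈ ⟦ L ⟧*)
  findNeg i []                = nothing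
  findNeg i (neg (atom j) ∷ L) with i ≟ j
  ... | yes refl = just (here refl)
  ... | no _     = Maybe.map there (findNeg i L)
  findNeg i (_ ∷ L)           = Maybe.map there (findNeg i L)

  complementary : ∀ K L → Maybe (Σ ℕ λ i → ρ i ∈ ⟦ K ⟧* × ~ ρ i ∈ ⟦ L ⟧*)
  complementary []            L = nothing
  complementary (atom i ∷ K)  L with findNeg i L
  ... | just p  = just (i , here refl , p)
  ... | nothing = Maybe.map (λ { (j , p , q) → j , there p , q }) (complementary K L)
  complementary (_ ∷ K)       L = Maybe.map (λ { (j , p , q) → j , there p , q }) (complementary K L)

  axiom : ∀ L → Maybe (⊢ ⋁ ⟦ L ⟧*)
  axiom L = Maybe.map close (complementary L L)
    where
    close : Σ ℕ (λ i → ρ i ∈ ⟦ L ⟧* × ~ ρ i ∈ ⟦ L ⟧*) → ⊢ ⋁ ⟦ L ⟧*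
    close (i , p , q) = ⋁-⊆ {~ ρ i ∷ ρ i ∷ []} (λ { (here refl) → q ; (there (here refl)) → p }) ⇒-refl

  -- Γ holds the formulas still to be decomposed, L the literals met so far.
  search : ℕ → ∀ Γ L → Maybe (⊢ ⋁ (⟦ Γ ⟧* ++ ⟦ L ⟧*))
  search zero    _                  _ = nothing
  search (suc n) []                 L = axiom L
  search (suc n) (atom i ∷ Γ)       L =
    Maybe.map (⋁-rotate ⟦ Γ ⟧* ⟦ L ⟧*) (search n Γ (atom i ∷ L))
  search (suc n) (neg (atom i) ∷ Γ) L =
    Maybe.map (⋁-rotate ⟦ Γ ⟧* ⟦ L ⟧*) (search n Γ (neg (atom i) ∷ L))
  search (suc n) (neg (neg a) ∷ Γ)  L =
    Maybe.map (⋁-head (⟦ Γ ⟧* ++ ⟦ L ⟧*) ¬¬-intro) (search n (a ∷ Γ) L)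
  search (suc n) (neg (or a b) ∷ Γ) L =
    Maybe.zipWith (⋁-¬∨ (⟦ Γ ⟧* ++ ⟦ L ⟧*)) (search n (neg a ∷ Γ) L) (search n (neg b ∷ Γ) L)
  search (suc n) (or a b ∷ Γ)       L =
    Maybe.map (⋁-∨ (⟦ Γ ⟧* ++ ⟦ L ⟧*)) (search n (a ∷ b ∷ Γ) L)

formulas : List Formula → ℕ → Formula
formulas []      _       = ⊥ᶠ
formulas (A ∷ _) zero    = A
formulas (_ ∷ Γ) (suc i) = formulas Γ i

-- The type reduces to ⊢ ⟦ a ⟧ exactly when the search succeeds; it needs at most size a + 1
-- steps, since every decomposition step shrinks the total size of Γ.
tautology : ∀ a (As : List Formula) → From-just (search (formulas As) (suc (size a)) (a ∷ []) [])
tautology a As = from-just (search (formulas As) (suc (size a)) (a ∷ []) [])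

infix 1 _⊩_
_⊩_ : Formula → Formula → Set
H ⊩ A = ⊢ (H ⇒ A)

weaken : ∀ {H A} → ⊢ A → H ⊩ A
weaken {H} {A} p = mp p (tautology (imp p₀ (imp p₁ p₀)) (A ∷ H ∷ []))

discharge : ∀ {A} → ⊤ᶠ ⊩ A → ⊢ A
discharge p = mp ⊤-intro p

assumption : ∀ {H} → H ⊩ H
assumption = ⇒-refl

hyp : ∀ {H A} → H ∧ A ⊩ A
hyp {H} {A} = tautology (imp (and p₀ p₁) p₁) (H ∷ A ∷ [])

wk : ∀ {H A B} → H ⊩ B → H ∧ A ⊩ B
wk {H} {A} p = ⇒-trans (tautology (imp (and p₀ p₁) p₀) (H ∷ A ∷ [])) p

⇒E : ∀ {H A B} → H ⊩ (A ⇒ B) → H ⊩ A → H ⊩ B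
⇒E {H} {A} {B} p q =
  mp p (mp q (tautology (imp (imp p₀ p₁) (imp (imp p₀ (imp p₁ p₂)) (imp p₀ p₂)))
                        (H ∷ A ∷ B ∷ [])))

⇒I : ∀ {H A B} → H ∧ A ⊩ B → H ⊩ (A ⇒ B)
⇒I {H} {A} {B} p =
  mp p (tautology (imp (imp (and p₀ p₁) p₂) (imp p₀ (imp p₁ p₂))) (H ∷ A ∷ B ∷ []))

by : ∀ {H A B} → ⊢ (A ⇒ B) → H ⊩ A → H ⊩ B
by r p = ⇒E (weaken r) p

by₂ : ∀ {H A B C} → ⊢ (A ⇒ (B ⇒ C)) → H ⊩ A → H ⊩ B → H ⊩ C
by₂ r p q = ⇒E (by r p) q

∧I : ∀ {H A B} → H ⊩ A → H ⊩ B → H ⊩ A ∧ B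
∧I {A = A} {B} = by₂ (tautology (imp p₀ (imp p₁ (and p₀ p₁))) (A ∷ B ∷ []))

∧E₁ : ∀ {H A B} → H ⊩ A ∧ B → H ⊩ A
∧E₁ {A = A} {B} = by (tautology (imp (and p₀ p₁) p₀) (A ∷ B ∷ []))

∧E₂ : ∀ {H A B} → H ⊩ A ∧ B → H ⊩ B
∧E₂ {A = A} {B} = by (tautology (imp (and p₀ p₁) p₁) (A ∷ B ∷ []))

∨I₁ : ∀ {H A B} → H ⊩ A → H ⊩ A ∨ B
∨I₁ {A = A} {B} = by (ax-weak A B)

∨I₂ : ∀ {H A B} → H ⊩ B → H ⊩ A ∨ B
∨I₂ {A = A} = by (∨-inr {A})

∨E : ∀ {H A B G} → H ⊩ A ∨ B → H ∧ A ⊩ G → H ∧ B ⊩ G → H ⊩ G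
∨E {H} {A} {B} {G} p q r = mp r (mp q (mp p (tautology
  (imp (imp p₀ (or p₁ p₂)) (imp (imp (and p₀ p₁) p₃) (imp (imp (and p₀ p₂) p₃) (imp p₀ p₃))))
  (H ∷ A ∷ B ∷ G ∷ []))))

⊥E : ∀ {H A G} → H ⊩ A → H ⊩ ~ A → H ⊩ G
⊥E {A = A} {G} = by₂ (tautology (imp p₀ (imp (neg p₀) p₁)) (A ∷ G ∷ []))

¬I : ∀ {H A} → H ∧ A ⊩ ~ A → H ⊩ ~ A
¬I {H} {A} p = mp p (tautology (imp (imp (and p₀ p₁) (neg p₁)) (imp p₀ (neg p₁))) (H ∷ A ∷ []))

-- Substitution and defining equations

sub-cong : ∀ {V W : Set} {σ τ : V → Tm W} → (∀ v → σ v ≡ τ v) → ∀ t → sub σ t ≡ sub τ t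
subs-cong : ∀ {V W : Set} {σ τ : V → Tm W} → (∀ v → σ v ≡ τ v) → ∀ {k} (ts : Vec (Tm V) k) →
  subs σ ts ≡ subs τ ts
sub-cong σ≗τ (var v)    = σ≗τ v
sub-cong σ≗τ (app f ts) = cong (app f) (subs-cong σ≗τ ts)
subs-cong σ≗τ []       = refl
subs-cong σ≗τ (t ∷ ts) = cong₂ _∷_ (sub-cong σ≗τ t) (subs-cong σ≗τ ts)

sub-sub : ∀ {U V W : Set} (σ : V → Tm W) (τ : U → Tm V) t → sub σ (sub τ t) ≡ sub (sub σ ∘ τ) t
subs-sub : ∀ {U V W : Set} (σ : V → Tm W) (τ : U → Tm V) {k} (ts : Vec (Tm U) k) →
  subs σ (subs τ ts) ≡ subs (sub σ ∘ τ) ts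
sub-sub σ τ (var v)    = refl
sub-sub σ τ (app f ts) = cong (app f) (subs-sub σ τ ts)
subs-sub σ τ []       = refl
subs-sub σ τ (t ∷ ts) = cong₂ _∷_ (sub-sub σ τ t) (subs-sub σ τ ts)

subs≡map : ∀ {V W : Set} (σ : V → Tm W) {k} (ts : Vec (Tm V) k) → subs σ ts ≡ map (sub σ) ts
subs≡map σ []       = refl
subs≡map σ (t ∷ ts) = cong (sub σ t ∷_) (subs≡map σ ts)

subs-tabulate : ∀ {V W : Set} (σ : V → Tm W) {k} (g : Fin k → Tm V) →
  subs σ (tabulate g) ≡ tabulate (sub σ ∘ g)
subs-tabulate σ g = trans (subs≡map σ (tabulate g)) (sym (tabulate-∘ (sub σ) g))

subs-[]≔ : ∀ {V W : Set} (σ : V → Tm W) {k} (ts : Vec (Tm V) k) j t →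
  subs σ (ts [ j ]≔ t) ≡ subs σ ts [ j ]≔ sub σ t
subs-[]≔ σ ts j t =
  trans (subs≡map σ _) (trans (map-[]≔ (sub σ) ts j) (cong (_[ j ]≔ _) (sym (subs≡map σ ts))))

subs-∷ʳ : ∀ {V W : Set} (σ : V → Tm W) {k} (ts : Vec (Tm V) k) t →
  subs σ (ts ∷ʳ t) ≡ subs σ ts ∷ʳ sub σ t
subs-∷ʳ σ []       t = refl
subs-∷ʳ σ (s ∷ ts) t = cong (sub σ s ∷_) (subs-∷ʳ σ ts t)

-- variables beyond the end of the vector are sent to 0
vecSub : ∀ {k} → Vec Term k → ℕ → Term
vecSub []       _       = Z
vecSub (t ∷ ts) zero    = t
vecSub (t ∷ ts) (suc i) = vecSub ts i

vecSub-toℕ : ∀ {k} (ts : Vec Term k) i → vecSub ts (toℕ i) ≡ lookup ts i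
vecSub-toℕ (t ∷ ts) fz     = refl
vecSub-toℕ (t ∷ ts) (fs i) = vecSub-toℕ ts i

vecSub-∷ʳ-toℕ : ∀ {k} (ts : Vec Term k) t i → vecSub (ts ∷ʳ t) (toℕ i) ≡ lookup ts i
vecSub-∷ʳ-toℕ (s ∷ ts) t fz     = refl
vecSub-∷ʳ-toℕ (s ∷ ts) t (fs i) = vecSub-∷ʳ-toℕ ts t i

vecSub-∷ʳ-last : ∀ {k} (ts : Vec Term k) t → vecSub (ts ∷ʳ t) k ≡ t
vecSub-∷ʳ-last []       t = refl
vecSub-∷ʳ-last (s ∷ ts) t = vecSub-∷ʳ-last ts t

subs-vars : ∀ {k} (σ : ℕ → Term) (ts : Vec Term k) → (∀ i → σ (toℕ i) ≡ lookup ts i) →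
  subs σ (vars k) ≡ ts
subs-vars σ ts σ≗ts = trans (subs-tabulate σ _) (trans (tabulate-cong σ≗ts) (tabulate∘lookup ts))

inst : ∀ {k} (ts : Vec Term k) {A} → ⊢ A → ⊢ subF (vecSub ts) A
inst ts = instance' (vecSub ts)

recF-zero : ∀ {k} (a : Tm (Fin k)) b (ts : Vec Term k) →
  ⊢ (app (recF a b) (ts ∷ʳ Z) ≐ sub (lookup ts) a)
recF-zero {k} a b ts =
  subst₂ (λ l r → ⊢ (app (recF a b) l ≐ r)) args body (inst (ts ∷ʳ Z) (ax-rec0 a b))
  where
  σ : ℕ → Term
  σ = vecSub (ts ∷ʳ Z)
  args : subs σ (vars k ∷ʳ Z) ≡ ts ∷ʳ Z
  args = trans (subs-∷ʳ σ (vars k) Z) (cong (_∷ʳ Z) (subs-vars σ ts (vecSub-∷ʳ-toℕ ts Z)))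
  body : sub σ (sub (var ∘ toℕ) a) ≡ sub (lookup ts) a
  body = trans (sub-sub σ (var ∘ toℕ) a) (sub-cong (vecSub-∷ʳ-toℕ ts Z) a)

recF-env : ∀ {k} (a : Tm (Fin k)) b → Vec Term k → Term → Fin (suc (suc k)) → Term
recF-env a b ts t fz           = app (recF a b) (ts ∷ʳ t)
recF-env a b ts t (fs fz)      = t
recF-env a b ts t (fs (fs i))  = lookup ts i

recF-suc : ∀ {k} (a : Tm (Fin k)) b (ts : Vec Term k) t →
  ⊢ (app (recF a b) (ts ∷ʳ S t) ≐ sub (recF-env a b ts t) b)
recF-suc {k} a b ts t =
  subst₂ (λ l r → ⊢ (app (recF a b) l ≐ r)) lhs
    (trans (sub-sub σ _ b) (sub-cong
      (λ { fz          → cong (app (recF a b)) (trans (args (var k)) (cong (ts ∷ʳ_) (vecSub-∷ʳ-last ts t)))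
         ; (fs fz)     → vecSub-∷ʳ-last ts t
         ; (fs (fs i)) → vecSub-∷ʳ-toℕ ts t i }) b))
    (inst (ts ∷ʳ t) (ax-recS a b))
  where
  σ : ℕ → Term
  σ = vecSub (ts ∷ʳ t)
  args : ∀ u → subs σ (vars k ∷ʳ u) ≡ ts ∷ʳ sub σ u
  args u = trans (subs-∷ʳ σ (vars k) u) (cong (_∷ʳ sub σ u) (subs-vars σ ts (vecSub-∷ʳ-toℕ ts t)))
  lhs : subs σ (vars k ∷ʳ S (var k)) ≡ ts ∷ʳ S t
  lhs = trans (args (S (var k))) (cong (λ u → ts ∷ʳ S u) (vecSub-∷ʳ-last ts t))

-- Equality and congruence

≐-sym⇒ : ∀ s t → ⊢ (s ≐ t ⇒ t ≐ s)
≐-sym⇒ s t = inst (s ∷ t ∷ []) ax-sym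

≐-trans⇒ : ∀ s t u → ⊢ (t ≐ u ⇒ (s ≐ t ⇒ s ≐ u))
≐-trans⇒ s t u = ⇒I (inst (t ∷ u ∷ s ∷ []) (ax-eq (var 2 ≐ var 0) 0 1))

≐-sym : ∀ {s t} → ⊢ (s ≐ t) → ⊢ (t ≐ s)
≐-sym {s} {t} p = mp p (≐-sym⇒ s t)

≐-trans : ∀ {s t u} → ⊢ (s ≐ t) → ⊢ (t ≐ u) → ⊢ (s ≐ u)
≐-trans {s} {t} {u} p q = mp p (mp q (≐-trans⇒ s t u))

symᴴ : ∀ {H s t} → H ⊩ s ≐ t → H ⊩ t ≐ s
symᴴ {s = s} {t} = by (≐-sym⇒ s t)

infixr 2 _≈⟨_⟩_ _≈˘⟨_⟩_
infix  3 _∎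

_≈⟨_⟩_ : ∀ {H} s {t u} → H ⊩ s ≐ t → H ⊩ t ≐ u → H ⊩ s ≐ u
_≈⟨_⟩_ s {t} {u} p q = by₂ (≐-trans⇒ s t u) q p

_≈˘⟨_⟩_ : ∀ {H} s {t u} → H ⊩ t ≐ s → H ⊩ t ≐ u → H ⊩ s ≐ u
s ≈˘⟨ p ⟩ q = s ≈⟨ symᴴ p ⟩ q

_∎ : ∀ {H} u → H ⊩ u ≐ u
u ∎ = weaken (≐-refl u)

Congruent : ∀ {k} → (Vec Term k → Term) → Set
Congruent F = ∀ ts j t → lookup ts j ≐ t ⊩ F ts ≐ F (ts [ j ]≔ t)

-- ax-eq replacing var 0 by var 1 in f(U) = f(U[j := var 0]) for the pattern U = (var 2, var 3, …),
-- instantiated with var 0, var 1, var (2 + i) := lookup ts j, t, lookup ts i.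
app-congruent : ∀ {k} (f : Fn k) → Congruent (app f)
app-congruent {k} f ts j t = ⇒-trans (∧I assumption (weaken (≐-refl (app f ts)))) instantiated
  where
  pattern-vec : Vec Term k
  pattern-vec = tabulate (λ i → var (2 + toℕ i))
  subs-pattern : ∀ σ u →
    subs σ (pattern-vec [ j ]≔ u) ≡ tabulate (λ i → σ (2 + toℕ i)) [ j ]≔ sub σ u
  subs-pattern σ u = trans (subs-[]≔ σ pattern-vec j u) (cong (_[ j ]≔ sub σ u) (subs-tabulate σ _))
  premise : Formula
  premise = var 0 ≐ var 1 ∧ app f pattern-vec ≐ app f (pattern-vec [ j ]≔ var 0)
  generic : ⊢ (premise ⇒ app f pattern-vec ≐ app f (pattern-vec [ j ]≔ var 1))
  generic = subst₂ (λ l r → ⊢ (premise ⇒ app f l ≐ app f r)) (subs-tabulate _ _) (subs-pattern _ (var 0))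
              (ax-eq (app f pattern-vec ≐ app f (pattern-vec [ j ]≔ var 0)) 0 1)
  σ : ℕ → Term
  σ = vecSub (lookup ts j ∷ t ∷ ts)
  ts-pattern : tabulate (λ i → σ (2 + toℕ i)) ≡ ts
  ts-pattern = trans (tabulate-cong (vecSub-toℕ ts)) (tabulate∘lookup ts)
  instantiated : ⊢ (lookup ts j ≐ t ∧ app f ts ≐ app f ts ⇒ app f ts ≐ app f (ts [ j ]≔ t))
  instantiated =
    subst₂ (λ l r → ⊢ (lookup ts j ≐ t ∧ app f l ≐ app f r ⇒ app f l ≐ app f (ts [ j ]≔ t)))
      (trans (subs-tabulate σ _) ts-pattern)
      (trans (subs-pattern σ (var 0)) (trans (cong (_[ j ]≔ lookup ts j) ts-pattern) ([]≔-lookup ts j)))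
      (subst (λ r → ⊢ (subF σ premise ⇒ app f (subs σ pattern-vec) ≐ app f r))
        (trans (subs-pattern σ (var 1)) (cong (_[ j ]≔ t) ts-pattern))
        (inst (lookup ts j ∷ t ∷ ts) generic))

congruent⇒cong : ∀ {k} {F : Vec Term k → Term} → Congruent F →
  ∀ ts us → (∀ j → ⊢ (lookup ts j ≐ lookup us j)) → ⊢ (F ts ≐ F us)
congruent⇒cong {F = F} cgr []       []       ts≐us = ≐-refl (F [])
congruent⇒cong {F = F} cgr (t ∷ ts) (u ∷ us) ts≐us =
  ≐-trans (mp (ts≐us fz) (cgr (t ∷ ts) fz u))
          (congruent⇒cong (λ vs j v → cgr (u ∷ vs) (fs j) v) ts us (ts≐us ∘ fs))

cong₁ : ∀ {H s t} (f : Fn 1) → H ⊩ s ≐ t → H ⊩ app f (s ∷ []) ≐ app f (t ∷ [])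
cong₁ {s = s} {t} f = by (app-congruent f (s ∷ []) fz t)

congˡ : ∀ {H s t r} (f : Fn 2) → H ⊩ s ≐ t → H ⊩ app f (s ∷ r ∷ []) ≐ app f (t ∷ r ∷ [])
congˡ {s = s} {t} {r} f = by (app-congruent f (s ∷ r ∷ []) fz t)

congʳ : ∀ {H s t r} (f : Fn 2) → H ⊩ s ≐ t → H ⊩ app f (r ∷ s ∷ []) ≐ app f (r ∷ t ∷ [])
congʳ {s = s} {t} {r} f = by (app-congruent f (r ∷ s ∷ []) (fs fz) t)

cong-S : ∀ {H s t} → H ⊩ s ≐ t → H ⊩ S s ≐ S t
cong-S = cong₁ sucF

cong-P : ∀ {H s t} → H ⊩ s ≐ t → H ⊩ P s ≐ P t
cong-P = cong₁ predF

cong-C : ∀ {H s t u v} → H ⊩ s ≐ t → H ⊩ C s u v ≐ C t u v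
cong-C {s = s} {t} {u} {v} = by (app-congruent condF (u ∷ v ∷ s ∷ []) (fs (fs fz)) t)

-- Closed terms

numeral : ℕ → Term
numeral zero    = Z
numeral (suc n) = S (numeral n)

eval : ∀ {V : Set} → Tm V → (V → ℕ) → ℕ
evalVec : ∀ {V : Set} {k} → Vec (Tm V) k → (V → ℕ) → Vec ℕ k
evalFn : ∀ {k} → Fn k → Vec ℕ k → ℕ
evalRec : ∀ {k} → Tm (Fin k) → Tm (Fin (suc (suc k))) → Vec ℕ k → ℕ → ℕ
evalEnv : ∀ {k} → Tm (Fin k) → Tm (Fin (suc (suc k))) → Vec ℕ k → ℕ → Fin (suc (suc k)) → ℕ

eval (var v)    ρ = ρ v
eval (app f ts) ρ = evalFn f (evalVec ts ρ)
evalVec []       ρ = []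
evalVec (t ∷ ts) ρ = eval t ρ ∷ evalVec ts ρ
evalFn zeroF      []      = 0
evalFn sucF       (n ∷ []) = suc n
evalFn (recF a b) ns      = evalRec a b (init ns) (last ns)
evalRec a b ns zero    = eval a (lookup ns)
evalRec a b ns (suc m) = eval b (evalEnv a b ns m)
evalEnv a b ns m fz          = evalRec a b ns m
evalEnv a b ns m (fs fz)     = m
evalEnv a b ns m (fs (fs i)) = lookup ns i

numeral-lookup : ∀ {k} (ns : Vec ℕ k) i → ⊢ (lookup (map numeral ns) i ≐ numeral (lookup ns i))
numeral-lookup ns i = subst (λ u → ⊢ (u ≐ numeral (lookup ns i))) (sym (lookup-map i numeral ns)) (≐-refl _)

eval-sound : ∀ {V : Set} (t : Tm V) (σ : V → Term) (ρ : V → ℕ) →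
  (∀ v → ⊢ (σ v ≐ numeral (ρ v))) → ⊢ (sub σ t ≐ numeral (eval t ρ))
evalVec-sound : ∀ {V : Set} {k} (ts : Vec (Tm V) k) (σ : V → Term) (ρ : V → ℕ) →
  (∀ v → ⊢ (σ v ≐ numeral (ρ v))) →
  ∀ j → ⊢ (lookup (subs σ ts) j ≐ lookup (map numeral (evalVec ts ρ)) j)
evalFn-sound : ∀ {k} (f : Fn k) ns → ⊢ (app f (map numeral ns) ≐ numeral (evalFn f ns))
evalRec-sound : ∀ {k} (a : Tm (Fin k)) b ns m →
  ⊢ (app (recF a b) (map numeral ns ∷ʳ numeral m) ≐ numeral (evalRec a b ns m))

eval-sound (var v)    σ ρ σ≐ρ = σ≐ρ v
eval-sound (app f ts) σ ρ σ≐ρ =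
  ≐-trans (congruent⇒cong (app-congruent f) _ _ (evalVec-sound ts σ ρ σ≐ρ)) (evalFn-sound f (evalVec ts ρ))
evalVec-sound (t ∷ ts) σ ρ σ≐ρ fz     = eval-sound t σ ρ σ≐ρ
evalVec-sound (t ∷ ts) σ ρ σ≐ρ (fs j) = evalVec-sound ts σ ρ σ≐ρ j

evalFn-sound zeroF      []       = ≐-refl Z
evalFn-sound sucF       (n ∷ []) = ≐-refl (S (numeral n))
evalFn-sound (recF a b) ns       =
  subst (λ us → ⊢ (app (recF a b) us ≐ numeral (evalFn (recF a b) ns)))
        (sym (trans (cong (map numeral) (proj₂ (proj₂ (initLast ns)))) (map-∷ʳ numeral (last ns) (init ns))))
        (evalRec-sound a b (init ns) (last ns))

evalRec-sound a b ns zero =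
  ≐-trans (recF-zero a b (map numeral ns)) (eval-sound a _ (lookup ns) (numeral-lookup ns))
evalRec-sound a b ns (suc m) =
  ≐-trans (recF-suc a b (map numeral ns) (numeral m)) (eval-sound b _ (evalEnv a b ns m) env≐)
  where
  env≐ : ∀ i → ⊢ (recF-env a b (map numeral ns) (numeral m) i ≐ numeral (evalEnv a b ns m i))
  env≐ fz          = evalRec-sound a b ns m
  env≐ (fs fz)     = ≐-refl (numeral m)
  env≐ (fs (fs i)) = numeral-lookup ns i

closed-eval : ∀ (t : Term) → ⊢ (sub (λ _ → Z) t ≐ numeral (eval t (λ _ → 0)))
closed-eval t = eval-sound t (λ _ → Z) (λ _ → 0) (λ _ → ≐-refl Z)

Q-one : ⊢ (Q one ≐ two)
Q-one = closed-eval (Q one)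

R-one : ⊢ (R one ≐ Z)
R-one = closed-eval (R one)

Q-two : ⊢ (Q two ≐ two)
Q-two = closed-eval (Q two)

R-two : ⊢ (R two ≐ one)
R-two = closed-eval (R two)

-- Arithmetic

x y : Term
x = var 0
y = var 1

zero/suc-cases : ∀ v {A} → ⊢ (A [ v ≔ Z ]) → ⊢ (A [ v ≔ S (var v) ]) → ⊢ A
zero/suc-cases v base step = ind v base (weaken step)

+-identityʳ : ∀ s → ⊢ (s +' Z ≐ s)
+-identityʳ s = recF-zero _ _ (s ∷ [])

+-suc : ∀ s t → ⊢ (s +' S t ≐ S (s +' t))
+-suc s t = recF-suc _ _ (s ∷ []) t

pred-zero : ⊢ (P Z ≐ Z)
pred-zero = recF-zero _ _ []

pred-suc : ∀ s → ⊢ (P (S s) ≐ s)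
pred-suc s = recF-suc _ _ [] s

∸-identityʳ : ∀ s → ⊢ (s -' Z ≐ s)
∸-identityʳ s = recF-zero _ _ (s ∷ [])

∸-suc : ∀ s t → ⊢ (s -' S t ≐ P (s -' t))
∸-suc s t = recF-suc _ _ (s ∷ []) t

·-zeroʳ : ∀ s → ⊢ (s · Z ≐ Z)
·-zeroʳ s = recF-zero _ _ (s ∷ [])

·-suc : ∀ s t → ⊢ (s · S t ≐ s +' (s · t))
·-suc s t = recF-suc _ _ (s ∷ []) t

C-zero : ∀ s t → ⊢ (C Z s t ≐ s)
C-zero s t = recF-zero _ _ (s ∷ t ∷ [])

C-suc : ∀ r s t → ⊢ (C (S r) s t ≐ t)
C-suc r s t = recF-suc _ _ (s ∷ t ∷ []) r

S≢Z : ∀ s → ⊢ (~ (S s ≐ Z))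
S≢Z s = inst (s ∷ []) ax-S≠0

+-identityˡ : ∀ s → ⊢ (Z +' s ≐ s)
+-identityˡ s = inst (s ∷ []) 0+x≐x
  where
  0+x≐x : ⊢ (Z +' x ≐ x)
  0+x≐x = ind 0 (+-identityʳ Z) (Z +' S x ≈⟨ weaken (+-suc Z x) ⟩ cong-S assumption)

+-sucˡ : ∀ s t → ⊢ (S s +' t ≐ S (s +' t))
+-sucˡ s t = inst (s ∷ t ∷ []) Sx+y≐S[x+y]
  where
  Sx+y≐S[x+y] : ⊢ (S x +' y ≐ S (x +' y))
  Sx+y≐S[x+y] = ind 1
    (discharge (S x +' Z ≈⟨ weaken (+-identityʳ (S x)) ⟩ cong-S (weaken (≐-sym (+-identityʳ x)))))
    (S x +' S y      ≈⟨ weaken (+-suc (S x) y) ⟩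
     S (S x +' y)    ≈⟨ cong-S assumption ⟩
     cong-S (weaken (≐-sym (+-suc x y))))

S∸S : ∀ s t → ⊢ (S s -' S t ≐ s -' t)
S∸S s t = inst (s ∷ t ∷ []) Sx∸Sy≐x∸y
  where
  Sx∸Sy≐x∸y : ⊢ (S x -' S y ≐ x -' y)
  Sx∸Sy≐x∸y = ind 1
    (discharge (S x -' S Z      ≈⟨ weaken (∸-suc (S x) Z) ⟩
                P (S x -' Z)    ≈⟨ cong-P (weaken (∸-identityʳ (S x))) ⟩
                P (S x)         ≈⟨ weaken (pred-suc x) ⟩
                weaken (≐-sym (∸-identityʳ x))))
    (S x -' S (S y)   ≈⟨ weaken (∸-suc (S x) (S y)) ⟩
     P (S x -' S y)   ≈⟨ cong-P assumption ⟩
     weaken (≐-sym (∸-suc x y)))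

n∸n≐0 : ∀ s → ⊢ (s -' s ≐ Z)
n∸n≐0 s = inst (s ∷ []) x∸x≐0
  where
  x∸x≐0 : ⊢ (x -' x ≐ Z)
  x∸x≐0 = ind 0 (∸-identityʳ Z) (S x -' S x ≈⟨ weaken (S∸S x x) ⟩ assumption)

Sn∸n≐1 : ∀ s → ⊢ (S s -' s ≐ one)
Sn∸n≐1 s = inst (s ∷ []) Sx∸x≐1
  where
  Sx∸x≐1 : ⊢ (S x -' x ≐ one)
  Sx∸x≐1 = ind 0 (∸-identityʳ one) (S (S x) -' S x ≈⟨ weaken (S∸S (S x) x) ⟩ assumption)

zero-or-suc : ∀ s → ⊢ (s ≐ Z ∨ s ≐ S (P s))
zero-or-suc s = inst (s ∷ []) x≐0∨x≐SPx
  where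
  x≐0∨x≐SPx : ⊢ (x ≐ Z ∨ x ≐ S (P x))
  x≐0∨x≐SPx = zero/suc-cases 0
    (discharge (∨I₁ (Z ∎)))
    (discharge (∨I₂ (S x ≈˘⟨ cong-S (weaken (pred-suc x)) ⟩ S (P (S x)) ∎)))

Sm≤n⇒m≤n : ∀ s t → ⊢ (S s ≤' t ⇒ s ≤' t)
Sm≤n⇒m≤n s t = inst (s ∷ t ∷ []) Sx≤y⇒x≤y
  where
  Sx≤y⇒x≤y : ⊢ (S x ≤' y ⇒ x ≤' y)
  Sx≤y⇒x≤y = zero/suc-cases 1
    (⊥E (S x ≈˘⟨ weaken (∸-identityʳ (S x)) ⟩ assumption) (weaken (S≢Z x)))
    (x -' S y          ≈⟨ weaken (∸-suc x y) ⟩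
     P (x -' y)        ≈˘⟨ cong-P (weaken (S∸S x y)) ⟩
     P (S x -' S y)    ≈⟨ cong-P assumption ⟩
     weaken pred-zero)

Sm+[n∸Sm]≐m+[n∸m] : ∀ s t → ⊢ (t -' s ≐ S (P (t -' s)) ⇒ S s +' (t -' S s) ≐ s +' (t -' s))
Sm+[n∸Sm]≐m+[n∸m] s t =
  S s +' (t -' S s)   ≈⟨ congʳ plusF (weaken (∸-suc t s)) ⟩
  S s +' P d          ≈⟨ weaken (+-sucˡ s (P d)) ⟩
  S (s +' P d)        ≈˘⟨ weaken (+-suc s (P d)) ⟩
  s +' S (P d)        ≈˘⟨ congʳ plusF assumption ⟩
  s +' d ∎
  where
  d : Term
  d = t -' s

0+[n∸0]≐n : ∀ t → ⊢ (Z +' (t -' Z) ≐ t)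
0+[n∸0]≐n t = discharge (Z +' (t -' Z) ≈⟨ congʳ plusF (weaken (∸-identityʳ t)) ⟩ weaken (+-identityˡ t))

m+[n∸m]≐n∨n≤m : ∀ s t → ⊢ (s +' (t -' s) ≐ t ∨ t ≤' s)
m+[n∸m]≐n∨n≤m s t = inst (s ∷ t ∷ []) total
  where
  d : Term
  d = y -' x
  total : ⊢ (x +' d ≐ y ∨ d ≐ Z)
  total = ind 0
    (discharge (∨I₁ (weaken (0+[n∸0]≐n y))))
    (∨E (weaken (zero-or-suc d))
      (∨I₂ (y -' S x ≈⟨ weaken (∸-suc y x) ⟩ P d ≈⟨ cong-P hyp ⟩ weaken pred-zero))
      (∨E (wk assumption)
        (∨I₁ (S x +' (y -' S x) ≈⟨ by (Sm+[n∸Sm]≐m+[n∸m] x y) (wk hyp) ⟩ hyp))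
        (⊥E (S (P d) ≈˘⟨ wk hyp ⟩ hyp) (weaken (S≢Z (P d))))))

m≤n⇒m+[n∸m]≐n : ∀ s t → ⊢ (s ≤' t ⇒ s +' (t -' s) ≐ t)
m≤n⇒m+[n∸m]≐n s t = inst (s ∷ t ∷ []) x≤y⇒x+d≐y
  where
  d : Term
  d = y -' x
  x≤y⇒x+d≐y : ⊢ (x ≤' y ⇒ x +' d ≐ y)
  x≤y⇒x+d≐y = ind 0
    (weaken (0+[n∸0]≐n y))
    (⇒I (∨E (weaken (zero-or-suc d))
      (⊥E (one             ≈˘⟨ weaken (Sn∸n≐1 x) ⟩
           S x -' x        ≈˘⟨ congʳ monusF y≐x ⟩
           wk hyp)
          (weaken (S≢Z Z)))
      (S x +' (y -' S x) ≈⟨ by (Sm+[n∸Sm]≐m+[n∸m] x y) hyp ⟩ wk x+d≐y)))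
    where
    x+d≐y : (x ≤' y ⇒ x +' d ≐ y) ∧ S x ≤' y ⊩ x +' d ≐ y
    x+d≐y = ⇒E (wk assumption) (by (Sm≤n⇒m≤n x y) hyp)
    y≐x : ((x ≤' y ⇒ x +' d ≐ y) ∧ S x ≤' y) ∧ d ≐ Z ⊩ y ≐ x
    y≐x = y ≈˘⟨ wk x+d≐y ⟩ x +' d ≈⟨ congʳ plusF hyp ⟩ weaken (+-identityʳ x)

≤-antisym : ∀ s t → ⊢ (s ≤' t ∧ t ≤' s ⇒ s ≐ t)
≤-antisym s t =
  s                  ≈˘⟨ weaken (+-identityʳ s) ⟩
  s +' Z             ≈˘⟨ congʳ plusF (∧E₂ assumption) ⟩
  by (m≤n⇒m+[n∸m]≐n s t) (∧E₁ assumption)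

-- Binary notation

2·_+1 : ∀ {V} → Tm V → Tm V
2· t +1 = S t +' t

cong-2·+1 : ∀ {H s t} → H ⊩ s ≐ t → H ⊩ 2· s +1 ≐ 2· t +1
cong-2·+1 {s = s} {t} p = 2· s +1 ≈⟨ congˡ plusF (cong-S p) ⟩ congʳ plusF p

2·S+1 : ∀ s → ⊢ (2· S s +1 ≐ S (S (2· s +1)))
2·S+1 s = discharge (S (S s) +' S s ≈⟨ weaken (+-suc (S (S s)) s) ⟩ cong-S (weaken (+-sucˡ (S s) s)))

S·2 : ∀ s → ⊢ (S s · two ≐ S (2· s +1))
S·2 s = discharge
  (S s · two                  ≈⟨ weaken (·-suc (S s) one) ⟩
   S s +' (S s · one)         ≈⟨ congʳ plusF (weaken (·-suc (S s) Z)) ⟩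
   S s +' (S s +' (S s · Z))  ≈⟨ congʳ plusF (congʳ plusF (weaken (·-zeroʳ (S s)))) ⟩
   S s +' (S s +' Z)          ≈⟨ congʳ plusF (weaken (+-identityʳ (S s))) ⟩
   weaken (+-suc (S s) s))

⊕-bit0 : ∀ s → ⊢ (s ⊕ bit0 ≐ 2· s +1)
⊕-bit0 s = discharge
  (s ⊕ bit0                       ≈⟨ cong-P (congˡ plusF (congʳ timesF (weaken Q-one))) ⟩
   P ((S s · two) +' R one)       ≈⟨ cong-P (congʳ plusF (weaken R-one)) ⟩
   P ((S s · two) +' Z)           ≈⟨ cong-P (weaken (+-identityʳ _)) ⟩
   P (S s · two)                  ≈⟨ cong-P (weaken (S·2 s)) ⟩
   weaken (pred-suc _))

⊕-bit1 : ∀ s → ⊢ (s ⊕ bit1 ≐ S (2· s +1))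
⊕-bit1 s = discharge
  (s ⊕ bit1                       ≈⟨ cong-P (congˡ plusF (congʳ timesF (weaken Q-two))) ⟩
   P ((S s · two) +' R two)       ≈⟨ cong-P (congʳ plusF (weaken R-two)) ⟩
   P ((S s · two) +' one)         ≈⟨ cong-P (weaken (+-suc _ _)) ⟩
   P (S ((S s · two) +' Z))       ≈⟨ weaken (pred-suc _) ⟩
   (S s · two) +' Z               ≈⟨ weaken (+-identityʳ _) ⟩
   weaken (S·2 s))

parityF halfF : Fn 1
parityF = recF Z (C (var fz) one Z)
halfF   = recF Z (C (app parityF (var (fs fz) ∷ [])) (var fz) (S (var fz)))

parity half chop : ∀ {V} → Tm V → Tm V
parity t = app parityF (t ∷ [])
half t   = app halfF (t ∷ [])
chop t   = half (P t)

chopsF : Fn 2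
chopsF = recF (var fz) (chop (var fz))

chops : ∀ {V} → Tm V → Tm V → Tm V
chops s t = app chopsF (s ∷ t ∷ [])

parity-zero : ⊢ (parity Z ≐ Z)
parity-zero = recF-zero _ _ []

parity-suc : ∀ s → ⊢ (parity (S s) ≐ C (parity s) one Z)
parity-suc s = recF-suc _ _ [] s

half-zero : ⊢ (half Z ≐ Z)
half-zero = recF-zero _ _ []

half-suc : ∀ s → ⊢ (half (S s) ≐ C (parity s) (half s) (S (half s)))
half-suc s = recF-suc _ _ [] s

chops-zero : ∀ s → ⊢ (chops s Z ≐ s)
chops-zero s = recF-zero _ _ (s ∷ [])

chops-suc : ∀ s t → ⊢ (chops s (S t) ≐ chop (chops s t))
chops-suc s t = recF-suc _ _ (s ∷ []) t

Even Odd : Term → Formula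
Even t = parity t ≐ Z ∧ S t ≐ 2· half t +1
Odd t  = parity t ≐ one ∧ S t ≐ S (2· half t +1)

C-if-zero : ∀ {H r s t} → H ⊩ r ≐ Z → H ⊩ C r s t ≐ s
C-if-zero {r = r} {s} {t} p = C r s t ≈⟨ cong-C p ⟩ weaken (C-zero s t)

C-if-suc : ∀ {H r q s t} → H ⊩ r ≐ S q → H ⊩ C r s t ≐ t
C-if-suc {r = r} {q} {s} {t} p = C r s t ≈⟨ cong-C p ⟩ weaken (C-suc q s t)

even-or-odd : ∀ s → ⊢ (Even s ∨ Odd s)
even-or-odd s = inst (s ∷ []) Even-x∨Odd-x
  where
  k : Term
  k = half x
  base : ⊤ᶠ ⊩ Even Z
  base = ∧I (weaken parity-zero) (one ≈˘⟨ weaken (+-identityʳ one) ⟩ cong-2·+1 (symᴴ (weaken half-zero)))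
  even⇒odd : ∀ {H} → H ∧ Even x ⊩ Odd (S x)
  even⇒odd = ∧I
    (parity (S x) ≈⟨ weaken (parity-suc x) ⟩ C-if-zero (∧E₁ hyp))
    (S (S x) ≈⟨ cong-S (∧E₂ hyp) ⟩
     cong-S (cong-2·+1 (k ≈˘⟨ C-if-zero (∧E₁ hyp) ⟩ weaken (≐-sym (half-suc x)))))
  odd⇒even : ∀ {H} → H ∧ Odd x ⊩ Even (S x)
  odd⇒even = ∧I
    (parity (S x) ≈⟨ weaken (parity-suc x) ⟩ C-if-suc (∧E₁ hyp))
    (S (S x)             ≈⟨ cong-S (∧E₂ hyp) ⟩
     S (S (2· k +1))     ≈˘⟨ weaken (2·S+1 k) ⟩
     cong-2·+1 (S k ≈˘⟨ C-if-suc (∧E₁ hyp) ⟩ weaken (≐-sym (half-suc x))))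
  Even-x∨Odd-x : ⊢ (Even x ∨ Odd x)
  Even-x∨Odd-x = ind 0 (discharge (∨I₁ base)) (∨E assumption (∨I₂ even⇒odd) (∨I₁ odd⇒even))

-- Length

module LengthProperties (L : Fn 1) (spec : ⊢ LengthSpec L) where

  ℓ : Term → Term
  ℓ t = app L (t ∷ [])

  cong-ℓ : ∀ {H s t} → H ⊩ s ≐ t → H ⊩ ℓ s ≐ ℓ t
  cong-ℓ = cong₁ L

  ℓ-ε : ⊢ (ℓ Z ≐ Z)
  ℓ-ε = discharge (∧E₁ (weaken spec))

  ℓ-⊕bit0 : ∀ s → ⊢ (ℓ (s ⊕ bit0) ≐ S (ℓ s))
  ℓ-⊕bit0 s = inst (s ∷ []) (discharge (∧E₁ (∧E₂ (weaken spec))))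

  ℓ-⊕bit1 : ∀ s → ⊢ (ℓ (s ⊕ bit1) ≐ S (ℓ s))
  ℓ-⊕bit1 s = inst (s ∷ []) (discharge (∧E₂ (∧E₂ (weaken spec))))

  ℓ-2·+1 : ∀ s → ⊢ (ℓ (2· s +1) ≐ S (ℓ s))
  ℓ-2·+1 s = discharge (ℓ (2· s +1) ≈˘⟨ cong-ℓ (weaken (⊕-bit0 s)) ⟩ weaken (ℓ-⊕bit0 s))

  ℓ-S2·+1 : ∀ s → ⊢ (ℓ (S (2· s +1)) ≐ S (ℓ s))
  ℓ-S2·+1 s = discharge (ℓ (S (2· s +1)) ≈˘⟨ cong-ℓ (weaken (⊕-bit1 s)) ⟩ weaken (ℓ-⊕bit1 s))

  ℓ-chop : ∀ s → ⊢ (s ≐ Z ∨ ℓ s ≐ S (ℓ (chop s)))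
  ℓ-chop s = inst (s ∷ []) x≐0∨ℓx≐Sℓchopx
    where
    k : Term
    k = half x
    ℓk≐ℓchopSx : ∀ {H} → H ⊩ ℓ k ≐ ℓ (chop (S x))
    ℓk≐ℓchopSx = cong-ℓ (cong₁ halfF (weaken (≐-sym (pred-suc x))))
    ℓ-chop-S : ⊤ᶠ ⊩ S x ≐ Z ∨ ℓ (S x) ≐ S (ℓ (chop (S x)))
    ℓ-chop-S = ∨I₂ (∨E (weaken (even-or-odd x))
      (ℓ (S x) ≈⟨ cong-ℓ (∧E₂ hyp) ⟩ ℓ (2· k +1) ≈⟨ weaken (ℓ-2·+1 k) ⟩ cong-S ℓk≐ℓchopSx)
      (ℓ (S x) ≈⟨ cong-ℓ (∧E₂ hyp) ⟩ ℓ (S (2· k +1)) ≈⟨ weaken (ℓ-S2·+1 k) ⟩ cong-S ℓk≐ℓchopSx))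
    x≐0∨ℓx≐Sℓchopx : ⊢ (x ≐ Z ∨ ℓ x ≐ S (ℓ (chop x)))
    x≐0∨ℓx≐Sℓchopx = zero/suc-cases 0 (discharge (∨I₁ (Z ∎))) (discharge ℓ-chop-S)

  ℓ-chop≐Pℓ : ∀ s → ⊢ (ℓ (chop s) ≐ P (ℓ s))
  ℓ-chop≐Pℓ s = discharge (∨E (weaken (ℓ-chop s))
    (ℓ (chop s)    ≈⟨ cong-ℓ (cong₁ halfF (cong-P hyp)) ⟩
     ℓ (chop Z)    ≈⟨ cong-ℓ (cong₁ halfF (weaken pred-zero)) ⟩
     ℓ (half Z)    ≈⟨ cong-ℓ (weaken half-zero) ⟩
     ℓ Z           ≈⟨ weaken ℓ-ε ⟩
     Z             ≈˘⟨ weaken pred-zero ⟩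
     P Z           ≈˘⟨ cong-P (weaken ℓ-ε) ⟩
     cong-P (cong-ℓ (symᴴ hyp)))
    (ℓ (chop s) ≈˘⟨ weaken (pred-suc _) ⟩ cong-P (symᴴ hyp)))

  ℓ≐0⇒≐0 : ∀ s → ⊢ (ℓ s ≐ Z ⇒ s ≐ Z)
  ℓ≐0⇒≐0 s = ∨E (weaken (ℓ-chop s))
    hyp
    (⊥E (S (ℓ (chop s)) ≈˘⟨ hyp ⟩ wk assumption) (weaken (S≢Z _)))

  ℓ-chops : ∀ s t → ⊢ (ℓ (chops s t) ≐ ℓ s -' t)
  ℓ-chops s t = inst (s ∷ t ∷ []) ℓ-chops-xy
    where
    ℓ-chops-xy : ⊢ (ℓ (chops x y) ≐ ℓ x -' y)
    ℓ-chops-xy = ind 1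
      (discharge (ℓ (chops x Z)  ≈⟨ cong-ℓ (weaken (chops-zero x)) ⟩
                  ℓ x            ≈˘⟨ weaken (∸-identityʳ (ℓ x)) ⟩
                  ℓ x -' Z ∎))
      (ℓ (chops x (S y))      ≈⟨ cong-ℓ (weaken (chops-suc x y)) ⟩
       ℓ (chop (chops x y))   ≈⟨ weaken (ℓ-chop≐Pℓ _) ⟩
       P (ℓ (chops x y))      ≈⟨ cong-P assumption ⟩
       P (ℓ x -' y)           ≈˘⟨ weaken (∸-suc (ℓ x) y) ⟩
       ℓ x -' S y ∎)

  chops-ℓ : ∀ s → ⊢ (chops s (ℓ s) ≐ Z)
  chops-ℓ s = mp (≐-trans (ℓ-chops s (ℓ s)) (n∸n≐0 (ℓ s))) (ℓ≐0⇒≐0 (chops s (ℓ s)))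

  Step : Term → Formula
  Step t = ℓ (S t) ≐ ℓ t ∨ ℓ (S t) ≐ S (ℓ t)

  Step-cong : ∀ {H s t} → H ⊩ s ≐ t → H ⊩ Step s → H ⊩ Step t
  Step-cong {s = s} {t} s≐t step = ∨E step
    (∨I₁ (ℓ (S t) ≈˘⟨ cong-ℓ (cong-S (wk s≐t)) ⟩ ℓ (S s) ≈⟨ hyp ⟩ cong-ℓ (wk s≐t)))
    (∨I₂ (ℓ (S t) ≈˘⟨ cong-ℓ (cong-S (wk s≐t)) ⟩ ℓ (S s) ≈⟨ hyp ⟩ cong-S (cong-ℓ (wk s≐t))))

  Step-zero : ⊢ (Step Z)
  Step-zero = discharge (∨I₂ (ℓ one ≈˘⟨ cong-ℓ (weaken (+-identityʳ one)) ⟩ weaken (ℓ-2·+1 Z)))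

  -- For s = S t write s = 2k+1 or s = 2k+2 with k = chop s: in the first case s+1 = 2k+2 has
  -- the length of s, in the second s+1 = 2(k+1)+1 and Step s reduces to Step k.
  Step-chop : ∀ s → ⊢ (Step (chop s) ⇒ Step s)
  Step-chop s = inst (s ∷ []) Step-chop-x
    where
    k : Term
    k = half x
    ℓSSx : ∀ {H} → H ∧ Odd x ⊩ ℓ (S (S x)) ≐ S (ℓ (S k))
    ℓSSx =
      ℓ (S (S x))          ≈⟨ cong-ℓ (cong-S (∧E₂ hyp)) ⟩
      ℓ (S (S (2· k +1)))  ≈˘⟨ cong-ℓ (weaken (2·S+1 k)) ⟩
      weaken (ℓ-2·+1 (S k))
    ℓSx : ∀ {H} → H ∧ Odd x ⊩ ℓ (S x) ≐ S (ℓ k)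
    ℓSx = ℓ (S x) ≈⟨ cong-ℓ (∧E₂ hyp) ⟩ weaken (ℓ-S2·+1 k)
    even : ∀ {H} → H ∧ Even x ⊩ Step (S x)
    even = ∨I₁
      (ℓ (S (S x))          ≈⟨ cong-ℓ (cong-S (∧E₂ hyp)) ⟩
       ℓ (S (2· k +1))      ≈⟨ weaken (ℓ-S2·+1 k) ⟩
       S (ℓ k)              ≈˘⟨ weaken (ℓ-2·+1 k) ⟩
       cong-ℓ (symᴴ (∧E₂ hyp)))
    odd : Step (chop (S x)) ∧ Odd x ⊩ Step (S x)
    odd = ∨E (Step-cong (cong₁ halfF (weaken (pred-suc x))) (wk assumption))
      (∨I₁ (ℓ (S (S x)) ≈⟨ wk ℓSSx ⟩ S (ℓ (S k)) ≈⟨ cong-S hyp ⟩ symᴴ (wk ℓSx)))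
      (∨I₂ (ℓ (S (S x)) ≈⟨ wk ℓSSx ⟩ S (ℓ (S k)) ≈⟨ cong-S hyp ⟩ cong-S (symᴴ (wk ℓSx))))
    Step-chop-x : ⊢ (Step (chop x) ⇒ Step x)
    Step-chop-x = zero/suc-cases 0 (weaken Step-zero) (∨E (weaken (even-or-odd x)) even odd)

  Step-chops : ∀ s t → ⊢ (Step (chops s t) ⇒ Step s)
  Step-chops s t = inst (s ∷ t ∷ []) Step-chops-xy
    where
    Step-chops-xy : ⊢ (Step (chops x y) ⇒ Step x)
    Step-chops-xy = ind 1
      (Step-cong (weaken (chops-zero x)) assumption)
      (⇒I (⇒E (wk assumption) (by (Step-chop (chops x y)) (Step-cong (weaken (chops-suc x y)) hyp))))

  Step-all : ∀ s → ⊢ (Step s)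
  Step-all s = mp (discharge (Step-cong (weaken (≐-sym (chops-ℓ s))) (weaken Step-zero)))
                  (Step-chops s (ℓ s))

  ℓ-mono : ∀ s t → ⊢ (ℓ s ≤' ℓ (s +' t))
  ℓ-mono s t = inst (s ∷ t ∷ []) ℓ-mono-xy
    where
    w : Term
    w = x +' y
    ℓx∸ℓ[x+Sy] : ∀ {H} → H ⊩ ℓ x -' ℓ (x +' S y) ≐ ℓ x -' ℓ (S w)
    ℓx∸ℓ[x+Sy] = congʳ monusF (cong-ℓ (weaken (+-suc x y)))
    ℓ-mono-xy : ⊢ (ℓ x ≤' ℓ w)
    ℓ-mono-xy = ind 1
      (discharge (ℓ x -' ℓ (x +' Z)  ≈⟨ congʳ monusF (cong-ℓ (weaken (+-identityʳ x))) ⟩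
                  weaken (n∸n≐0 (ℓ x))))
      (∨E (weaken (Step-all w))
        (ℓ x -' ℓ (x +' S y) ≈⟨ ℓx∸ℓ[x+Sy] ⟩ ℓ x -' ℓ (S w) ≈⟨ congʳ monusF hyp ⟩ wk assumption)
        (ℓ x -' ℓ (x +' S y)  ≈⟨ ℓx∸ℓ[x+Sy] ⟩
         ℓ x -' ℓ (S w)       ≈⟨ congʳ monusF hyp ⟩
         ℓ x -' S (ℓ w)       ≈⟨ weaken (∸-suc _ _) ⟩
         P (ℓ x -' ℓ w)       ≈⟨ cong-P (wk assumption) ⟩
         weaken pred-zero))

mainTheorem19 : (Length : Fn 1) → ⊢ LengthSpec Length →
    ⊢ ((var 0 ≺[ Length ] var 1) ⇒ (var 0 <' var 1))
mainTheorem19 Length spec = ∧I x≤y x≢y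
  where
  open LengthProperties Length spec
  x≢y : x ≺[ Length ] y ⊩ ~ (x ≐ y)
  x≢y = ¬I (⊥E (cong-ℓ hyp) (wk (∧E₂ assumption)))
  -- Either x ≤ y, or x = y + (x ∸ y) and then ℓ y ≤ ℓ x by monotonicity.
  x≤y : x ≺[ Length ] y ⊩ x ≤' y
  x≤y = ∨E (weaken (m+[n∸m]≐n∨n≤m y x))
    (⊥E (by (≤-antisym (ℓ x) (ℓ y))
           (∧I (wk (∧E₁ assumption))
               (ℓ y -' ℓ x ≈˘⟨ congʳ monusF (cong-ℓ hyp) ⟩ weaken (ℓ-mono y (x -' y)))))
        (wk (∧E₂ assumption)))
    hyp
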